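{- Let $p$ be a prime, $V=\mathbb{Z}_p^d$, and let $G=V\rtimes H$ act on $V$ as an affine permutation group (translations by $V$, linear action of $H$), where $1\neq H\leqslant \mathrm{GL}_d(p)$. Suppose $G$ is $\frac{3}{2}$-transitive on $V$. If $H$ has exactly three orbits on $V\setminus\{0\}$, then $G$ is primitive.
   Context: A transitive permutation group is $\frac{3}{2}$-transitive if it is not regular and all nontrivial orbits of a point stabiliser (those other than the fixed point itself) have equal size. -}

module Defs where

open import Data.Nat using (ℕ; zero; suc; NonZero)
open import Data.Nat.DivMod using (_mod_)
open import Data.Fin as Fin using (Fin; toℕ)
open import Data.Vec as Vec using (Vec; []; _∷_; zipWith; replicate; transpose; tabulate)
open import Data.Vec.Properties using (≡-dec)
open import Data.List as List using (List; [_]; concatMap; length; filter; cartesianProduct)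
open import Data.List.Relation.Unary.Any using (Any; any?)
open import Data.Product using (Σ; ∃; _×_; _,_; proj₁; proj₂)
open import Data.Sum using (_⊎_)
open import Data.Bool using (Bool; true; false)
open import Relation.Nullary using (¬_; Dec; _×-dec_)
open import Relation.Binary.PropositionalEquality using (_≡_; _≢_)

module _ {p : ℕ} .{{_ : NonZero p}} where

  _+ₚ_ : Fin p → Fin p → Fin p
  a +ₚ b = (toℕ a Data.Nat.+ toℕ b) mod p

  _*ₚ_ : Fin p → Fin p → Fin p
  a *ₚ b = (toℕ a Data.Nat.* toℕ b) mod p

  0ₚ : Fin p
  0ₚ = 0 mod p

  1ₚ : Fin p
  1ₚ = 1 mod p

-- The vector space V = ℤ_p^d and d×d matrices over ℤ_p (lists of rows).
Vect : (p d : ℕ) → Set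
Vect p d = Vec (Fin p) d

Mat : (p d : ℕ) → Set
Mat p d = Vec (Vec (Fin p) d) d

module _ {p : ℕ} .{{_ : NonZero p}} {d : ℕ} where

  zeroV : Vect p d
  zeroV = replicate d 0ₚ

  _⊕_ : Vect p d → Vect p d → Vect p d
  _⊕_ = zipWith _+ₚ_

  dot : ∀ {n} → Vec (Fin p) n → Vec (Fin p) n → Fin p
  dot u v = Vec.foldr _ _+ₚ_ 0ₚ (zipWith _*ₚ_ u v)

  _·_ : Mat p d → Vect p d → Vect p d
  A · x = Vec.map (λ row → dot row x) A

  _⊗_ : Mat p d → Mat p d → Mat p d
  A ⊗ B = Vec.map (λ row → Vec.map (λ col → dot row col) (transpose B)) A

  idMat : Mat p d
  idMat = tabulate (λ i → tabulate (λ j → if⁇ i j))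
    where
    if⁇ : Fin d → Fin d → Fin p
    if⁇ i j with i Fin.≟ j
    ... | Relation.Nullary.yes _ = 1ₚ
    ... | Relation.Nullary.no _  = 0ₚ

record MatGroup (p : ℕ) .{{_ : NonZero p}} (d : ℕ) : Set₁ where
  field
    mem     : Mat p d → Set
    mem?    : (A : Mat p d) → Dec (mem A)
    id∈H    : mem idMat
    mul∈H   : ∀ {A B} → mem A → mem B → mem (A ⊗ B)
    inv∈H   : ∀ {A} → mem A → Σ (Mat p d) λ B → mem B × (A ⊗ B ≡ idMat) × (B ⊗ A ≡ idMat)

open MatGroup public

allVecs : ∀ {A : Set} (n : ℕ) → List A → List (Vec A n)
allVecs zero    xs = [ [] ]
allVecs (suc n) xs = concatMap (λ x → List.map (x ∷_) (allVecs n xs)) xs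

module _ {p : ℕ} .{{_ : NonZero p}} {d : ℕ} where

  allV : List (Vect p d)
  allV = allVecs d (List.allFin p)

  allM : List (Mat p d)
  allM = allVecs d allV

  _≟V_ : (x y : Vect p d) → Dec (x ≡ y)
  _≟V_ = ≡-dec Fin._≟_

-- The affine group G = V ⋊ H acting on V:  (A , v) : x ↦ A x + v,  A ∈ H.

module _ {p : ℕ} .{{_ : NonZero p}} {d : ℕ} (H : MatGroup p d) where

  InG : Mat p d × Vect p d → Set
  InG (A , v) = mem H A

  act : Mat p d × Vect p d → Vect p d → Vect p d
  act (A , v) x = (A · x) ⊕ v

  Transitive : Set
  Transitive = ∀ x y → Σ (Mat p d × Vect p d) λ g → InG g × act g x ≡ y

  Regular : Set
  Regular = Transitive × (∀ g → InG g → ∀ x → act g x ≡ x → ∀ y → act g y ≡ y)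

  -- z lies in the orbit of x under the point stabiliser G_a
  -- (witnessed by an element of G from the complete enumeration V⋊GL)
  InStabOrbit : (a x z : Vect p d) → Set
  InStabOrbit a x z =
    Any (λ g → InG g × (act g a ≡ a) × (act g x ≡ z)) (cartesianProduct allM allV)

  inStabOrbit? : (a x z : Vect p d) → Dec (InStabOrbit a x z)
  inStabOrbit? a x z =
    any? (λ g → mem? H (proj₁ g) ×-dec ((act g a ≟V a) ×-dec (act g x ≟V z)))
         (cartesianProduct allM allV)

  stabOrbitSize : (a x : Vect p d) → ℕ
  stabOrbitSize a x = length (filter (inStabOrbit? a x) allV)

  ThreeHalvesTransitive : Set
  ThreeHalvesTransitive =
    Transitive × ¬ Regular ×
    (∀ a x y → x ≢ a → y ≢ a → stabOrbitSize a x ≡ stabOrbitSize a y)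

  SameHOrbit : Vect p d → Vect p d → Set
  SameHOrbit x y = Σ (Mat p d) λ A → mem H A × A · x ≡ y

  ExactlyThreeOrbits : Set
  ExactlyThreeOrbits =
    Σ (Vect p d) λ u₁ → Σ (Vect p d) λ u₂ → Σ (Vect p d) λ u₃ →
      (u₁ ≢ zeroV) × (u₂ ≢ zeroV) × (u₃ ≢ zeroV) ×
      ¬ SameHOrbit u₁ u₂ × ¬ SameHOrbit u₁ u₃ × ¬ SameHOrbit u₂ u₃ ×
      (∀ v → v ≢ zeroV → SameHOrbit u₁ v ⊎ SameHOrbit u₂ v ⊎ SameHOrbit u₃ v)

  NontrivialH : Set
  NontrivialH = Σ (Mat p d) λ A → mem H A × A ≢ idMat

  IsBlock : (Vect p d → Bool) → Set
  IsBlock B = ∀ g → InG g →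
    (∀ x → B (act g x) ≡ B x) ⊎ (∀ x → B x ≡ true → B (act g x) ≡ false)

  TrivialBlock : (Vect p d → Bool) → Set
  TrivialBlock B =
    (∀ x y → B x ≡ true → B y ≡ true → x ≡ y) ⊎ (∀ x → B x ≡ true)

  Primitive : Set
  Primitive = Transitive × (∀ B → IsBlock B → TrivialBlock B)

-- Translating a block B through one of its points a gives a set C = B − a containing 0 which, by
-- the block property, is closed under translation by its own elements (an additive subgroup) and
-- invariant under H = G₀.  So C is {0} together with some of the three H-orbits; these have a
-- common size s, and s ≥ 2 since otherwise H acts trivially and G is regular.  The complement N of
-- a proper subgroup is a union of cosets of C, so ∣N∣ = ∣C∣ or ∣N∣ ≥ 2∣C∣.  If k of the orbits lie
-- in C then ∣C∣ = 1 + ks and ∣N∣ = (3 − k)s, which rules out k = 1 and k = 2; if B has two points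
-- then k ≠ 0, so k = 3 and B = V.

module Submission where

open import Defs
open import Data.Nat using (ℕ; NonZero)
open import Data.Nat.Primality using (Prime)

open import Algebra.Bundles using (CommutativeRing; AbelianGroup)
open import Algebra.Structures using (IsCommutativeRing; IsAbelianGroup)
open import Data.Bool as Bool using (Bool; true; false)
open import Data.Empty using (⊥; ⊥-elim)
open import Data.Fin as Fin using (Fin; toℕ)
open import Data.Fin.Properties using (toℕ-injective; toℕ<n; toℕ-fromℕ<; punchInᵢ≢i)
open import Data.List as List using (List; []; _∷_; [_]; length; filter; cartesianProductWith; concatMap; _++_)
import Data.List.Properties as List
open import Data.List.Membership.Propositional using (_∈_; lose)
open import Data.List.Membership.Propositional.Properties
  using (∈-filter⁺; ∈-filter⁻; ∈-map⁻; ∈-++⁺ˡ; ∈-++⁺ʳ; ∈-++⁻; ∈-cartesianProductWith⁺; ∈-cartesianProduct⁺; ∈-allFin)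
open import Data.List.Relation.Binary.Subset.Propositional using (_⊆_)
open import Data.List.Relation.Unary.All as All using (All; []; _∷_)
import Data.List.Relation.Unary.All.Properties as AllP
open import Data.List.Relation.Unary.AllPairs using ([]; _∷_)
open import Data.List.Relation.Unary.Any as Any using (here; there)
open import Data.List.Relation.Unary.Unique.Propositional using (Unique)
import Data.List.Relation.Unary.Unique.Propositional.Properties as Unique
open import Data.Nat as ℕ using (zero; suc; _+_; _*_; _∸_; _%_; _≤_; z≤n; s≤s)
import Data.Nat.Properties as ℕ
open import Data.Nat.DivMod using (_mod_; %-distribˡ-+; %-distribˡ-*; [m+n]%n≡m%n; m<n⇒m%n≡m)
open import Data.Product using (Σ; ∃; ∃₂; _×_; _,_; proj₁; proj₂)
open import Data.Sum as Sum using (_⊎_; inj₁; inj₂; [_,_]′)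
open import Data.Vec as Vec using (Vec; []; _∷_; lookup; tabulate; transpose; replicate)
import Data.Vec.Properties as Vec
open import Data.Vec.Functional using (Vector)
open import Function using (_∘_; id; case_of_)
open import Level using (0ℓ)
open import Relation.Binary.Definitions using (DecidableEquality)
open import Relation.Binary.PropositionalEquality hiding ([_])
open import Relation.Binary.PropositionalEquality.Algebra using (isMagma)
open import Relation.Nullary using (¬_; yes; no; contradiction; _→-dec_; _⊎-dec_)
open import Relation.Unary using (Pred; Decidable)

module Enumeration {A : Set} where

  concatMap≡cartesianProductWith : ∀ {B C : Set} (f : A → B → C) xs ys →
    concatMap (λ x → List.map (f x) ys) xs ≡ cartesianProductWith f xs ys
  concatMap≡cartesianProductWith f []       ys = refl
  concatMap≡cartesianProductWith f (x ∷ xs) ys =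
    cong (List.map (f x) ys ++_) (concatMap≡cartesianProductWith f xs ys)

  allVecs-complete : ∀ {xs : List A} → (∀ x → x ∈ xs) → ∀ n (v : Vec A n) → v ∈ allVecs n xs
  allVecs-complete complete zero    []      = here refl
  allVecs-complete {xs} complete (suc n) (x ∷ v) =
    subst (x ∷ v ∈_) (sym (concatMap≡cartesianProductWith _∷_ xs (allVecs n xs)))
      (∈-cartesianProductWith⁺ _∷_ (complete x) (allVecs-complete complete n v))

  allVecs-unique : ∀ {xs : List A} → Unique xs → ∀ n → Unique (allVecs n xs)
  allVecs-unique unique zero    = [] ∷ []
  allVecs-unique {xs} unique (suc n) =
    subst Unique (sym (concatMap≡cartesianProductWith _∷_ xs (allVecs n xs)))
      (Unique.cartesianProductWith⁺ _∷_ Vec.∷-injective unique (allVecs-unique unique n))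

∈-─ : ∀ {A : Set} {x y : A} {ys} (y∈ys : y ∈ ys) → x ∈ ys → x ≢ y → x ∈ (ys Any.─ y∈ys)
∈-─ (here refl) (here refl) x≢y = contradiction refl x≢y
∈-─ (here _)    (there x∈)  _   = x∈
∈-─ (there _)   (here refl) _   = here refl
∈-─ (there y∈)  (there x∈)  x≢y = there (∈-─ y∈ x∈ x≢y)

unique∧⊆⇒length≤ : ∀ {A : Set} {xs ys : List A} → Unique xs → xs ⊆ ys → length xs ≤ length ys
unique∧⊆⇒length≤ []               _  = z≤n
unique∧⊆⇒length≤ {ys = ys} (x∉xs ∷ u) xs⊆ys = ℕ.≤-trans
  (s≤s (unique∧⊆⇒length≤ u λ w∈xs → ∈-─ x∈ys (xs⊆ys (there w∈xs)) (λ { refl → All.lookup x∉xs w∈xs refl })))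
  (ℕ.≤-reflexive (sym (List.length-removeAt′ ys (Any.index x∈ys))))
  where x∈ys = xs⊆ys (here refl)

module Counting {A : Set} (enum : List A) (complete : ∀ x → x ∈ enum) (unique : Unique enum)
                (_≟_ : DecidableEquality A) where

  #_ : {P : Pred A 0ℓ} → Decidable P → ℕ
  # P? = length (filter P? enum)

  module _ {P : Pred A 0ℓ} (P? : Decidable P) where

    ∈-filter : ∀ {x} → P x → x ∈ filter P? enum
    ∈-filter Px = ∈-filter⁺ P? (complete _) Px

    filter-sound : ∀ {x} → x ∈ filter P? enum → P x
    filter-sound = proj₂ ∘ ∈-filter⁻ P? {xs = enum}

    filter-unique : Unique (filter P? enum)
    filter-unique = Unique.filter⁺ P? unique

  module _ {P Q : Pred A 0ℓ} (P? : Decidable P) (Q? : Decidable Q) where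

    count-injective : (f : A → A) → (∀ {x y} → f x ≡ f y → x ≡ y) → (∀ {x} → P x → Q (f x)) → # P? ≤ # Q?
    count-injective f f-inj P⇒Qf = subst (_≤ # Q?) (List.length-map f (filter P? enum))
      (unique∧⊆⇒length≤ (Unique.map⁺ f-inj (filter-unique P?)) λ y∈ →
        let (x , x∈ , y≡fx) = ∈-map⁻ f y∈ in subst (_∈ _) (sym y≡fx) (∈-filter Q? (P⇒Qf (filter-sound P? x∈))))

    count-mono : (∀ {x} → P x → Q x) → # P? ≤ # Q?
    count-mono = count-injective id id

    module _ {R : Pred A 0ℓ} (R? : Decidable R) where

      count-disjoint : (∀ {x} → P x → Q x → ⊥) → (∀ {x} → P x → R x) → (∀ {x} → Q x → R x) →
                       # P? + # Q? ≤ # R?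
      count-disjoint P∩Q=∅ P⊆R Q⊆R = subst (_≤ # R?) (List.length-++ (filter P? enum))
        (unique∧⊆⇒length≤
          (Unique.++⁺ (filter-unique P?) (filter-unique Q?)
            (λ (x∈P , x∈Q) → P∩Q=∅ (filter-sound P? x∈P) (filter-sound Q? x∈Q)))
          λ {x} x∈ → ∈-filter R? ([ P⊆R ∘ filter-sound P? , Q⊆R ∘ filter-sound Q? ]′ (∈-++⁻ (filter P? enum) x∈)))

      count-union : (∀ {x} → R x → P x ⊎ Q x) → # R? ≤ # P? + # Q?
      count-union R⊆P∪Q = subst (# R? ≤_) (List.length-++ (filter P? enum))
        (unique∧⊆⇒length≤ (filter-unique R?)
          λ x∈ → [ ∈-++⁺ˡ ∘ ∈-filter P? , ∈-++⁺ʳ _ ∘ ∈-filter Q? ]′ (R⊆P∪Q (filter-sound R? x∈)))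

  count-singleton : ∀ a → # (_≟ a) ≡ 1
  count-singleton a = ℕ.≤-antisym
    (unique∧⊆⇒length≤ {ys = [ a ]} (filter-unique (_≟ a)) λ x∈ → here (filter-sound (_≟ a) x∈))
    (unique∧⊆⇒length≤ ([] ∷ []) λ { (here refl) → ∈-filter (_≟ a) refl })

  count≤1⇒unique : ∀ {P : Pred A 0ℓ} (P? : Decidable P) → # P? ≤ 1 → ∀ {x y} → P x → P y → x ≡ y
  count≤1⇒unique P? #P≤1 {x} {y} Px Py with x ≟ y
  ... | yes x≡y = x≡y
  ... | no  x≢y = contradiction (ℕ.≤-trans two≤#P #P≤1) λ { (s≤s ()) }
    where
    two≤#P : 2 ≤ # P?
    two≤#P = unique∧⊆⇒length≤ ((x≢y ∷ []) ∷ [] ∷ [])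
      λ { (here refl) → ∈-filter P? Px ; (there (here refl)) → ∈-filter P? Py }

  ∀⊎∃¬ : ∀ {P : Pred A 0ℓ} → Decidable P → (∀ x → P x) ⊎ ∃ λ x → ¬ P x
  ∀⊎∃¬ P? with All.all? P? enum
  ... | yes all = inj₁ λ x → All.lookup all (complete x)
  ... | no ¬all = inj₂ (Any.satisfied (AllP.¬All⇒Any¬ P? enum ¬all))

  atMostOne⊎twoDistinct : ∀ {P : Pred A 0ℓ} → Decidable P →
                          (∀ x y → P x → P y → x ≡ y) ⊎ ∃₂ λ x y → P x × P y × x ≢ y
  atMostOne⊎twoDistinct {P} P? = by-filter (filter P? enum) (filter-unique P?) (∈-filter P?) (filter-sound P?)
    where
    by-filter : ∀ ys → Unique ys → (∀ {x} → P x → x ∈ ys) → (∀ {x} → x ∈ ys → P x) →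
         (∀ x y → P x → P y → x ≡ y) ⊎ ∃₂ λ x y → P x × P y × x ≢ y
    by-filter []       _ P⊆ _ = inj₁ λ x _ Px _ → case P⊆ Px of λ ()
    by-filter (z ∷ []) _ P⊆ _ = inj₁ λ x y Px Py → trans (only (P⊆ Px)) (sym (only (P⊆ Py)))
      where
      only : ∀ {x} → x ∈ [ z ] → x ≡ z
      only (here x≡z) = x≡z
    by-filter (z ∷ w ∷ _) ((z≢w ∷ _) ∷ _) _ ⊆P = inj₂ (z , w , ⊆P (here refl) , ⊆P (there (here refl)) , z≢w)

module ℤₚ {p : ℕ} .{{_ : NonZero p}} where

  open import Algebra.Definitions {A = Fin p} _≡_
  open import Algebra.Consequences.Propositional {A = Fin p} using (comm∧idˡ⇒id; comm∧invʳ⇒inv; comm∧distrˡ⇒distrʳ)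
  open ≡-Reasoning

  [_]ₚ : ℕ → Fin p
  [ m ]ₚ = m mod p

  infix 25 -ₚ_
  -ₚ_ : Fin p → Fin p
  -ₚ a = [ p ∸ toℕ a ]ₚ

  toℕ-[] : ∀ m → toℕ [ m ]ₚ ≡ m % p
  toℕ-[] m = toℕ-fromℕ< _

  []-toℕ : ∀ a → [ toℕ a ]ₚ ≡ a
  []-toℕ a = toℕ-injective (trans (toℕ-[] (toℕ a)) (m<n⇒m%n≡m (toℕ<n a)))

  []-%-cong : ∀ {m n} → m % p ≡ n % p → [ m ]ₚ ≡ [ n ]ₚ
  []-%-cong {m} {n} e = toℕ-injective (trans (toℕ-[] m) (trans e (sym (toℕ-[] n))))

  +-hom : ∀ m n → [ m ]ₚ +ₚ [ n ]ₚ ≡ [ m + n ]ₚ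
  +-hom m n = []-%-cong (begin
    (toℕ [ m ]ₚ + toℕ [ n ]ₚ) % p ≡⟨ cong₂ (λ a b → (a + b) % p) (toℕ-[] m) (toℕ-[] n) ⟩
    (m % p + n % p) % p           ≡⟨ %-distribˡ-+ m n p ⟨
    (m + n) % p                 ∎)

  *-hom : ∀ m n → [ m ]ₚ *ₚ [ n ]ₚ ≡ [ m * n ]ₚ
  *-hom m n = []-%-cong (begin
    (toℕ [ m ]ₚ * toℕ [ n ]ₚ) % p ≡⟨ cong₂ (λ a b → (a * b) % p) (toℕ-[] m) (toℕ-[] n) ⟩
    (m % p * (n % p)) % p         ≡⟨ %-distribˡ-* m n p ⟨
    (m * n) % p                 ∎)

  -- Every residue is [ m ]ₚ for some m, so laws of ℕ pass to Fin p along +-hom and *-hom.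
  residue-elim : (P : Fin p → Set) → (∀ m → P [ m ]ₚ) → ∀ a → P a
  residue-elim P h a = subst P ([]-toℕ a) (h (toℕ a))

  +-assoc : Associative _+ₚ_
  +-assoc = residue-elim _ λ m → residue-elim _ λ n → residue-elim _ λ k → begin
    ([ m ]ₚ +ₚ [ n ]ₚ) +ₚ [ k ]ₚ ≡⟨ cong (_+ₚ [ k ]ₚ) (+-hom m n) ⟩
    [ m + n ]ₚ +ₚ [ k ]ₚ         ≡⟨ +-hom (m + n) k ⟩
    [ m + n + k ]ₚ               ≡⟨ cong [_]ₚ (ℕ.+-assoc m n k) ⟩
    [ m + (n + k) ]ₚ             ≡⟨ +-hom m (n + k) ⟨
    [ m ]ₚ +ₚ [ n + k ]ₚ         ≡⟨ cong ([ m ]ₚ +ₚ_) (+-hom n k) ⟨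
    [ m ]ₚ +ₚ ([ n ]ₚ +ₚ [ k ]ₚ) ∎

  +-comm : Commutative _+ₚ_
  +-comm = residue-elim _ λ m → residue-elim _ λ n → begin
    [ m ]ₚ +ₚ [ n ]ₚ ≡⟨ +-hom m n ⟩
    [ m + n ]ₚ       ≡⟨ cong [_]ₚ (ℕ.+-comm m n) ⟩
    [ n + m ]ₚ       ≡⟨ +-hom n m ⟨
    [ n ]ₚ +ₚ [ m ]ₚ ∎

  +-identityˡ : LeftIdentity 0ₚ _+ₚ_
  +-identityˡ = residue-elim _ λ m → +-hom 0 m

  +-inverseʳ : RightInverse 0ₚ -ₚ_ _+ₚ_
  +-inverseʳ a = begin
    a +ₚ -ₚ a                    ≡⟨ cong (_+ₚ -ₚ a) ([]-toℕ a) ⟨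
    [ toℕ a ]ₚ +ₚ [ p ∸ toℕ a ]ₚ ≡⟨ +-hom (toℕ a) (p ∸ toℕ a) ⟩
    [ toℕ a + (p ∸ toℕ a) ]ₚ     ≡⟨ cong [_]ₚ (ℕ.m+[n∸m]≡n (ℕ.<⇒≤ (toℕ<n a))) ⟩
    [ p ]ₚ                       ≡⟨ []-%-cong ([m+n]%n≡m%n 0 p) ⟩
    [ 0 ]ₚ                       ∎

  *-assoc : Associative _*ₚ_
  *-assoc = residue-elim _ λ m → residue-elim _ λ n → residue-elim _ λ k → begin
    ([ m ]ₚ *ₚ [ n ]ₚ) *ₚ [ k ]ₚ ≡⟨ cong (_*ₚ [ k ]ₚ) (*-hom m n) ⟩
    [ m * n ]ₚ *ₚ [ k ]ₚ         ≡⟨ *-hom (m * n) k ⟩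
    [ m * n * k ]ₚ               ≡⟨ cong [_]ₚ (ℕ.*-assoc m n k) ⟩
    [ m * (n * k) ]ₚ             ≡⟨ *-hom m (n * k) ⟨
    [ m ]ₚ *ₚ [ n * k ]ₚ         ≡⟨ cong ([ m ]ₚ *ₚ_) (*-hom n k) ⟨
    [ m ]ₚ *ₚ ([ n ]ₚ *ₚ [ k ]ₚ) ∎

  *-comm : Commutative _*ₚ_
  *-comm = residue-elim _ λ m → residue-elim _ λ n → begin
    [ m ]ₚ *ₚ [ n ]ₚ ≡⟨ *-hom m n ⟩
    [ m * n ]ₚ       ≡⟨ cong [_]ₚ (ℕ.*-comm m n) ⟩
    [ n * m ]ₚ       ≡⟨ *-hom n m ⟨
    [ n ]ₚ *ₚ [ m ]ₚ ∎

  *-identityˡ : LeftIdentity 1ₚ _*ₚ_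
  *-identityˡ = residue-elim _ λ m → trans (*-hom 1 m) (cong [_]ₚ (ℕ.*-identityˡ m))

  *-distribˡ-+ : _*ₚ_ DistributesOverˡ _+ₚ_
  *-distribˡ-+ = residue-elim _ λ m → residue-elim _ λ n → residue-elim _ λ k → begin
    [ m ]ₚ *ₚ ([ n ]ₚ +ₚ [ k ]ₚ)             ≡⟨ cong ([ m ]ₚ *ₚ_) (+-hom n k) ⟩
    [ m ]ₚ *ₚ [ n + k ]ₚ                     ≡⟨ *-hom m (n + k) ⟩
    [ m * (n + k) ]ₚ                         ≡⟨ cong [_]ₚ (ℕ.*-distribˡ-+ m n k) ⟩
    [ m * n + m * k ]ₚ                       ≡⟨ +-hom (m * n) (m * k) ⟨
    [ m * n ]ₚ +ₚ [ m * k ]ₚ                 ≡⟨ cong₂ _+ₚ_ (*-hom m n) (*-hom m k) ⟨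
    ([ m ]ₚ *ₚ [ n ]ₚ) +ₚ ([ m ]ₚ *ₚ [ k ]ₚ) ∎

  isCommutativeRing : IsCommutativeRing _≡_ _+ₚ_ _*ₚ_ -ₚ_ 0ₚ 1ₚ
  isCommutativeRing = record
    { isRing = record
      { +-isAbelianGroup = record
        { isGroup = record
          { isMonoid = record
            { isSemigroup = record { isMagma = isMagma _+ₚ_ ; assoc = +-assoc }
            ; identity    = comm∧idˡ⇒id +-comm +-identityˡ
            }
          ; inverse = comm∧invʳ⇒inv +-comm +-inverseʳ
          ; ⁻¹-cong = cong -ₚ_
          }
        ; comm = +-comm
        }
      ; *-cong     = cong₂ _*ₚ_
      ; *-assoc    = *-assoc
      ; *-identity = comm∧idˡ⇒id *-comm *-identityˡ
      ; distrib    = *-distribˡ-+ , comm∧distrˡ⇒distrʳ *-comm *-distribˡ-+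
      }
    ; *-comm = *-comm
    }

  commutativeRing : CommutativeRing _ _
  commutativeRing = record { isCommutativeRing = isCommutativeRing }

module MatrixAction {p : ℕ} .{{_ : NonZero p}} {d : ℕ} where

  open ℤₚ {p} using (commutativeRing)
  open CommutativeRing commutativeRing
    using (semiring; *-assoc; *-identityˡ; zeroˡ; distribˡ; +-identityʳ)
  open import Algebra.Properties.Semiring.Sum semiring
    using (sum; ∑-comm; ∑-distrib-+; *-distribˡ-sum; *-distribʳ-sum; sum-cong-≗; sum-remove; sum-replicate-zero)
  open ≡-Reasoning

  entry : Mat p d → Fin d → Fin d → Fin p
  entry A i j = lookup (lookup A i) j

  vec-ext : ∀ {A : Set} {n} {x y : Vec A n} → (∀ i → lookup x i ≡ lookup y i) → x ≡ y
  vec-ext {x = x} {y} x≗y = begin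
    x                   ≡⟨ Vec.tabulate∘lookup x ⟨
    tabulate (lookup x) ≡⟨ Vec.tabulate-cong x≗y ⟩
    tabulate (lookup y) ≡⟨ Vec.tabulate∘lookup y ⟩
    y                   ∎

  -- dot takes the dimension d as an unused implicit argument, which must be given explicitly.
  dot≡sum : ∀ {n} (u v : Vec (Fin p) n) → dot {d = d} u v ≡ sum (λ k → lookup u k *ₚ lookup v k)
  dot≡sum []      []      = refl
  dot≡sum (a ∷ u) (b ∷ v) = cong ((a *ₚ b) +ₚ_) (dot≡sum u v)

  lookup-transpose-∷ : ∀ {A : Set} {m n} (r : Vec A n) (B : Vec (Vec A n) m) j →
                       lookup (transpose (r ∷ B)) j ≡ lookup r j ∷ lookup (transpose B) j
  lookup-transpose-∷ {n = n} r B j = begin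
    lookup ((replicate n Vec._∷_ Vec.⊛ r) Vec.⊛ transpose B) j
      ≡⟨ Vec.lookup-⊛ j (replicate n Vec._∷_ Vec.⊛ r) (transpose B) ⟩
    lookup (replicate n Vec._∷_ Vec.⊛ r) j (lookup (transpose B) j)
      ≡⟨ cong (λ f → f (lookup (transpose B) j)) (Vec.lookup-⊛ j (replicate n Vec._∷_) r) ⟩
    lookup (replicate n Vec._∷_) j (lookup r j) (lookup (transpose B) j)
      ≡⟨ cong (λ f → f (lookup r j) (lookup (transpose B) j)) (Vec.lookup-replicate j Vec._∷_) ⟩
    lookup r j ∷ lookup (transpose B) j ∎

  lookup-transpose : ∀ {A : Set} {m n} (B : Vec (Vec A n) m) j k →
                     lookup (lookup (transpose B) j) k ≡ lookup (lookup B k) j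
  lookup-transpose (r ∷ B) j Fin.zero    = cong (λ c → lookup c Fin.zero) (lookup-transpose-∷ r B j)
  lookup-transpose (r ∷ B) j (Fin.suc k) =
    trans (cong (λ c → lookup c (Fin.suc k)) (lookup-transpose-∷ r B j)) (lookup-transpose B j k)

  sum-select : ∀ {n} (f : Vector (Fin p) n) i → (∀ k → k ≢ i → f k ≡ 0ₚ) → sum f ≡ f i
  sum-select {suc n} f i f≡0 = begin
    sum f                                  ≡⟨ sum-remove {i = i} f ⟩
    f i +ₚ sum (λ k → f (Fin.punchIn i k)) ≡⟨ cong (f i +ₚ_) (sum-cong-≗ (λ k → f≡0 _ (punchInᵢ≢i i k))) ⟩
    f i +ₚ sum {n} (λ _ → 0ₚ)              ≡⟨ cong (f i +ₚ_) (sum-replicate-zero n) ⟩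
    f i +ₚ 0ₚ                              ≡⟨ +-identityʳ (f i) ⟩
    f i                                    ∎

  lookup-· : ∀ A x i → lookup (A · x) i ≡ sum (λ k → entry A i k *ₚ lookup x k)
  lookup-· A x i = trans (Vec.lookup-map i _ A) (dot≡sum (lookup A i) x)

  entry-⊗ : ∀ A B i j → entry (A ⊗ B) i j ≡ sum (λ k → entry A i k *ₚ entry B k j)
  entry-⊗ A B i j = begin
    entry (A ⊗ B) i j
      ≡⟨ cong (λ r → lookup r j) (Vec.lookup-map i _ A) ⟩
    lookup (Vec.map (dot {d = d} (lookup A i)) (transpose B)) j
      ≡⟨ Vec.lookup-map j _ (transpose B) ⟩
    dot {d = d} (lookup A i) (lookup (transpose B) j)
      ≡⟨ dot≡sum (lookup A i) _ ⟩
    sum (λ k → entry A i k *ₚ lookup (lookup (transpose B) j) k)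
      ≡⟨ sum-cong-≗ (λ k → cong (entry A i k *ₚ_) (lookup-transpose B j k)) ⟩
    sum (λ k → entry A i k *ₚ entry B k j) ∎

  ·-⊗ : ∀ A B x → (A ⊗ B) · x ≡ A · (B · x)
  ·-⊗ A B x = vec-ext λ i → begin
    lookup ((A ⊗ B) · x) i
      ≡⟨ lookup-· (A ⊗ B) x i ⟩
    sum (λ j → entry (A ⊗ B) i j *ₚ lookup x j)
      ≡⟨ sum-cong-≗ (λ j → cong (_*ₚ lookup x j) (entry-⊗ A B i j)) ⟩
    sum (λ j → sum (λ k → entry A i k *ₚ entry B k j) *ₚ lookup x j)
      ≡⟨ sum-cong-≗ (λ j → *-distribʳ-sum (lookup x j) (λ k → entry A i k *ₚ entry B k j)) ⟩
    sum (λ j → sum (λ k → (entry A i k *ₚ entry B k j) *ₚ lookup x j))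
      ≡⟨ ∑-comm (λ j k → (entry A i k *ₚ entry B k j) *ₚ lookup x j) ⟩
    sum (λ k → sum (λ j → (entry A i k *ₚ entry B k j) *ₚ lookup x j))
      ≡⟨ sum-cong-≗ (λ k → sum-cong-≗ (λ j → *-assoc (entry A i k) (entry B k j) (lookup x j))) ⟩
    sum (λ k → sum (λ j → entry A i k *ₚ (entry B k j *ₚ lookup x j)))
      ≡⟨ sum-cong-≗ (λ k → *-distribˡ-sum (entry A i k) (λ j → entry B k j *ₚ lookup x j)) ⟨
    sum (λ k → entry A i k *ₚ sum (λ j → entry B k j *ₚ lookup x j))
      ≡⟨ sum-cong-≗ (λ k → cong (entry A i k *ₚ_) (lookup-· B x k)) ⟨
    sum (λ k → entry A i k *ₚ lookup (B · x) k)
      ≡⟨ lookup-· A (B · x) i ⟨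
    lookup (A · (B · x)) i ∎

  ·-distrib-⊕ : ∀ A x y → A · (x ⊕ y) ≡ (A · x) ⊕ (A · y)
  ·-distrib-⊕ A x y = vec-ext λ i → begin
    lookup (A · (x ⊕ y)) i
      ≡⟨ lookup-· A (x ⊕ y) i ⟩
    sum (λ k → entry A i k *ₚ lookup (x ⊕ y) k)
      ≡⟨ sum-cong-≗ (λ k → trans (cong (entry A i k *ₚ_) (Vec.lookup-zipWith _ k x y))
                                 (distribˡ (entry A i k) (lookup x k) (lookup y k))) ⟩
    sum (λ k → (entry A i k *ₚ lookup x k) +ₚ (entry A i k *ₚ lookup y k))
      ≡⟨ ∑-distrib-+ (λ k → entry A i k *ₚ lookup x k) (λ k → entry A i k *ₚ lookup y k) ⟩
    sum (λ k → entry A i k *ₚ lookup x k) +ₚ sum (λ k → entry A i k *ₚ lookup y k)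
      ≡⟨ cong₂ _+ₚ_ (lookup-· A x i) (lookup-· A y i) ⟨
    lookup (A · x) i +ₚ lookup (A · y) i
      ≡⟨ Vec.lookup-zipWith _ i (A · x) (A · y) ⟨
    lookup ((A · x) ⊕ (A · y)) i ∎

  entry-tabulate : ∀ (f : Fin d → Fin d → Fin p) i j → entry (tabulate (λ i → tabulate (f i))) i j ≡ f i j
  entry-tabulate f i j = trans (cong (λ r → lookup r j) (Vec.lookup∘tabulate _ i)) (Vec.lookup∘tabulate (f i) j)

  -- The entries of idMat are given by a local function of Defs that cannot be named, so the
  -- right-hand side is left to unification and reached below by abstracting over i Fin.≟ j.
  idMat-entry : ∀ i j → entry idMat i j ≡ _
  idMat-entry = entry-tabulate _

  idMat-diag : ∀ i → entry idMat i i ≡ 1ₚ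
  idMat-diag i with i Fin.≟ i | idMat-entry i i
  ... | yes _   | e = e
  ... | no i≢i | _ = ⊥-elim (i≢i refl)

  idMat-off : ∀ {i j} → i ≢ j → entry idMat i j ≡ 0ₚ
  idMat-off {i} {j} i≢j with i Fin.≟ j | idMat-entry i j
  ... | yes i≡j | _ = ⊥-elim (i≢j i≡j)
  ... | no _    | e = e

  idMat-· : ∀ x → idMat · x ≡ x
  idMat-· x = vec-ext λ i → begin
    lookup (idMat · x) i                      ≡⟨ lookup-· idMat x i ⟩
    sum (λ k → entry idMat i k *ₚ lookup x k) ≡⟨ sum-select _ i off-diagonal ⟩
    entry idMat i i *ₚ lookup x i             ≡⟨ cong (_*ₚ lookup x i) (idMat-diag i) ⟩
    1ₚ *ₚ lookup x i                          ≡⟨ *-identityˡ (lookup x i) ⟩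
    lookup x i                                ∎
    where
    off-diagonal : ∀ {i} k → k ≢ i → entry idMat i k *ₚ lookup x k ≡ 0ₚ
    off-diagonal k k≢i = trans (cong (_*ₚ lookup x k) (idMat-off (k≢i ∘ sym))) (zeroˡ (lookup x k))

module VectorSpace {p : ℕ} .{{_ : NonZero p}} {d : ℕ} where

  open ℤₚ {p} using (-ₚ_; commutativeRing)
  open CommutativeRing commutativeRing using (+-assoc; +-identity; -‿inverse; +-comm)
  open MatrixAction {p} {d} public using (·-⊗; ·-distrib-⊕; idMat-·)

  V : Set
  V = Vect p d

  infix 25 ⊝_
  ⊝_ : V → V
  ⊝_ = Vec.map -ₚ_

  infixl 6 _⊖_
  _⊖_ : V → V → V
  x ⊖ y = x ⊕ ⊝ y

  isAbelianGroup : IsAbelianGroup _≡_ _⊕_ zeroV ⊝_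
  isAbelianGroup = record
    { isGroup = record
      { isMonoid = record
        { isSemigroup = record { isMagma = isMagma _⊕_ ; assoc = Vec.zipWith-assoc +-assoc }
        ; identity    = Vec.zipWith-identityˡ (proj₁ +-identity) , Vec.zipWith-identityʳ (proj₂ +-identity)
        }
      ; inverse = Vec.zipWith-inverseˡ (proj₁ -‿inverse) , Vec.zipWith-inverseʳ (proj₂ -‿inverse)
      ; ⁻¹-cong = cong ⊝_
      }
    ; comm = Vec.zipWith-comm +-comm
    }

  abelianGroup : AbelianGroup _ _
  abelianGroup = record { isAbelianGroup = isAbelianGroup }

  open AbelianGroup abelianGroup public using (assoc; comm; identityˡ; identityʳ)
  open import Algebra.Properties.Group (AbelianGroup.group abelianGroup) public
    using (//-rightDividesˡ; //-rightDividesʳ; x∙y⁻¹≈ε⇒x≈y; quasigroup; loop)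
  open import Algebra.Properties.Quasigroup quasigroup public using (cancelʳ)
  open import Algebra.Properties.Loop loop public using (identityʳ-unique)
  open import Algebra.Properties.AbelianGroup abelianGroup public using (xyx⁻¹≈y)
  open import Algebra.Properties.CommutativeSemigroup (AbelianGroup.commutativeSemigroup abelianGroup) public
    using (xy∙z≈yz∙x)

  allV-complete : ∀ (x : V) → x ∈ allV
  allV-complete = Enumeration.allVecs-complete ∈-allFin d

  allV-unique : Unique (allV {p} {d})
  allV-unique = Enumeration.allVecs-unique (Unique.allFin⁺ p) d

  allM-complete : ∀ (A : Mat p d) → A ∈ allM
  allM-complete = Enumeration.allVecs-complete allV-complete d

  open Counting allV allV-complete allV-unique _≟V_ public

  ⊖-telescope : ∀ x w v → (x ⊖ w) ⊕ (w ⊖ v) ≡ x ⊖ v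
  ⊖-telescope x w v = trans (sym (assoc (x ⊖ w) w (⊝ v))) (cong (_⊖ v) (//-rightDividesˡ w x))

  ·-zero : ∀ A → A · zeroV ≡ zeroV
  ·-zero A = identityʳ-unique (A · zeroV) (A · zeroV)
    (trans (sym (·-distrib-⊕ A zeroV zeroV)) (cong (A ·_) (identityˡ zeroV)))

  #-translate : ∀ {P : Pred V 0ℓ} (P? : Decidable P) v → # (λ x → P? (x ⊖ v)) ≡ # P?
  #-translate {P} P? v = ℕ.≤-antisym
    (count-injective _ P? (_⊖ v) (cancelʳ (⊝ v) _ _) id)
    (count-injective P? _ (_⊕ v) (cancelʳ v _ _) λ {x} Px → subst P (sym (//-rightDividesʳ v x)) Px)

true≢false : ∀ {b} → b ≡ true → b ≡ false → ⊥
true≢false refl ()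

¬[≡false→≡true] : ∀ {b c : Bool} → ¬ (b ≡ false → c ≡ true) → b ≡ false × c ≡ false
¬[≡false→≡true] {false} {false} _ = refl , refl
¬[≡false→≡true] {false} {true}  h = contradiction (λ _ → refl) h
¬[≡false→≡true] {true}          h = contradiction (λ ()) h

module Subgroup {p : ℕ} .{{_ : NonZero p}} {d : ℕ} (C : Vect p d → Bool)
                (translate-by-member : ∀ {t} → C t ≡ true → ∀ v → C (t ⊕ v) ≡ C v) where

  open VectorSpace {p} {d}
  open ≡-Reasoning

  member? : Decidable (λ x → C x ≡ true)
  member? x = C x Bool.≟ true

  nonmember? : Decidable (λ x → C x ≡ false)
  nonmember? x = C x Bool.≟ false

  coset? : ∀ v → Decidable (λ x → C (x ⊖ v) ≡ true)
  coset? v x = member? (x ⊖ v)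

  #member≤#nonmember : ∀ {v} → C v ≡ false → # member? ≤ # nonmember?
  #member≤#nonmember {v} Cv =
    count-injective member? nonmember? (_⊕ v) (cancelʳ v _ _) λ Cx → trans (translate-by-member Cx v) Cv

  coset⊆nonmembers : ∀ {v x} → C v ≡ false → C (x ⊖ v) ≡ true → C x ≡ false
  coset⊆nonmembers {v} {x} Cv Cx-v = begin
    C x             ≡⟨ cong C (//-rightDividesˡ v x) ⟨
    C ((x ⊖ v) ⊕ v) ≡⟨ translate-by-member Cx-v v ⟩
    C v             ≡⟨ Cv ⟩
    false           ∎

  cosets-disjoint : ∀ {v w x} → C (w ⊖ v) ≡ false → C (x ⊖ v) ≡ true → C (x ⊖ w) ≡ true → ⊥
  cosets-disjoint {v} {w} {x} Cw-v Cx-v Cx-w = contradiction (begin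
    true                  ≡⟨ Cx-v ⟨
    C (x ⊖ v)             ≡⟨ cong C (⊖-telescope x w v) ⟨
    C ((x ⊖ w) ⊕ (w ⊖ v)) ≡⟨ translate-by-member Cx-w (w ⊖ v) ⟩
    C (w ⊖ v)             ≡⟨ Cw-v ⟩
    false                    ∎) λ ()

  -- The complement is a union of cosets, each as large as C: either one or at least two of them.
  complement-size : ∀ {v} → C v ≡ false → # nonmember? ≡ # member? ⊎ # member? + # member? ≤ # nonmember?
  complement-size {v} Cv with ∀⊎∃¬ (λ x → nonmember? x →-dec coset? v x)
  ... | inj₁ N⊆v+C = inj₁ (ℕ.≤-antisym
        (ℕ.≤-trans (count-mono nonmember? (coset? v) (N⊆v+C _)) (ℕ.≤-reflexive (#-translate member? v)))
        (#member≤#nonmember Cv))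
  ... | inj₂ (w , w∉v+C) = inj₂ (ℕ.≤-trans
        (ℕ.≤-reflexive (sym (cong₂ _+_ (#-translate member? v) (#-translate member? w))))
        (count-disjoint (coset? v) (coset? w) nonmember?
          (cosets-disjoint Cw-v) (coset⊆nonmembers Cv) (coset⊆nonmembers Cw)))
    where
    Cw : C w ≡ false
    Cw = proj₁ (¬[≡false→≡true] w∉v+C)
    Cw-v : C (w ⊖ v) ≡ false
    Cw-v = proj₂ (¬[≡false→≡true] w∉v+C)

module AffineGroup {p : ℕ} .{{_ : NonZero p}} {d : ℕ} (H : MatGroup p d) where

  open VectorSpace {p} {d}
  open ≡-Reasoning

  inverse-action : ∀ {A} → mem H A → Σ (Mat p d) λ B → mem H B × ∀ x → B · (A · x) ≡ x
  inverse-action {A} A∈H with inv∈H H A∈H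
  ... | B , B∈H , _ , BA≡1 = B , B∈H , λ x → trans (sym (·-⊗ B A x)) (trans (cong (_· x) BA≡1) (idMat-· x))

  same-refl : ∀ u → SameHOrbit H u u
  same-refl u = idMat , id∈H H , idMat-· u

  same-sym : ∀ {u w} → SameHOrbit H u w → SameHOrbit H w u
  same-sym {u} (A , A∈H , refl) with inverse-action A∈H
  ... | B , B∈H , B·A·≗id = B , B∈H , B·A·≗id u

  same-trans : ∀ {u v w} → SameHOrbit H u v → SameHOrbit H v w → SameHOrbit H u w
  same-trans {u} (A , A∈H , refl) (B , B∈H , refl) = B ⊗ A , mul∈H H B∈H A∈H , ·-⊗ B A u

  same-zero : ∀ {u} → SameHOrbit H u zeroV → u ≡ zeroV
  same-zero u∼0 with same-sym u∼0
  ... | A , _ , A0≡u = trans (sym A0≡u) (·-zero A)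

  -- The stabiliser of zeroV in G is H itself, so the G₀-orbits are the H-orbits.
  Orbit : V → V → Set
  Orbit = InStabOrbit H zeroV

  orbit? : ∀ u → Decidable (Orbit u)
  orbit? = inStabOrbit? H zeroV

  orbitSize : V → ℕ
  orbitSize = stabOrbitSize H zeroV

  orbit⇒same : ∀ {u w} → Orbit u w → SameHOrbit H u w
  orbit⇒same {u} {w} u↦w with Any.satisfied u↦w
  ... | (A , v) , A∈H , A0+v≡0 , Au+v≡w = A , A∈H , (begin
    A · u           ≡⟨ identityʳ (A · u) ⟨
    (A · u) ⊕ zeroV ≡⟨ cong ((A · u) ⊕_) v≡0 ⟨
    (A · u) ⊕ v     ≡⟨ Au+v≡w ⟩
    w               ∎)
    where
    v≡0 : v ≡ zeroV
    v≡0 = trans (sym (identityˡ v)) (trans (cong (_⊕ v) (sym (·-zero A))) A0+v≡0)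

  same⇒orbit : ∀ {u w} → SameHOrbit H u w → Orbit u w
  same⇒orbit {u} (A , A∈H , Au≡w) = lose (∈-cartesianProduct⁺ (allM-complete A) (allV-complete zeroV))
    (A∈H , trans (identityʳ (A · zeroV)) (·-zero A) , trans (identityʳ (A · u)) Au≡w)

  small-orbits⇒trivial-action : (∀ u → u ≢ zeroV → orbitSize u ≤ 1) → ∀ {A} → mem H A → ∀ w → A · w ≡ w
  small-orbits⇒trivial-action small {A} A∈H w with w ≟V zeroV
  ... | yes refl = ·-zero A
  ... | no  w≢0  = sym (count≤1⇒unique (orbit? w) (small w w≢0)
                         (same⇒orbit (same-refl w)) (same⇒orbit (A , A∈H , refl)))

  small-orbits⇒regular : Transitive H → (∀ u → u ≢ zeroV → orbitSize u ≤ 1) → Regular H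
  small-orbits⇒regular transitive small = transitive , λ where
    (A , v) A∈H x Ax+v≡x y →
      let A-trivial = small-orbits⇒trivial-action small A∈H
          v≡0 = identityʳ-unique x v (trans (cong (_⊕ v) (sym (A-trivial x))) Ax+v≡x)
      in trans (cong₂ _⊕_ (A-trivial y) v≡0) (identityʳ y)

  nonregular⇒large-orbits : Transitive H → ¬ Regular H →
                            (∀ x y → x ≢ zeroV → y ≢ zeroV → orbitSize x ≡ orbitSize y) →
                            ∀ u → u ≢ zeroV → 2 ≤ orbitSize u
  nonregular⇒large-orbits transitive nonregular equal-sizes u u≢0 = ℕ.≰⇒> λ u≤1 →
    nonregular (small-orbits⇒regular transitive λ w w≢0 → ℕ.≤-trans (ℕ.≤-reflexive (equal-sizes w u w≢0 u≢0)) u≤1)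

  module Block (B : V → Bool) (isBlock : IsBlock H B) {a : V} (Ba : B a ≡ true) where

    C : V → Bool
    C w = B (w ⊕ a)

    C-zero : C zeroV ≡ true
    C-zero = trans (cong B (identityˡ a)) Ba

    translation : ∀ t x → act H (idMat , t) x ≡ x ⊕ t
    translation t x = cong (_⊕ t) (idMat-· x)

    translate-by-member : ∀ {t} → C t ≡ true → ∀ v → C (t ⊕ v) ≡ C v
    translate-by-member {t} Ct v with isBlock (idMat , t) (id∈H H)
    ... | inj₁ fixed = begin
      B ((t ⊕ v) ⊕ a)               ≡⟨ cong B (xy∙z≈yz∙x t v a) ⟩
      B ((v ⊕ a) ⊕ t)               ≡⟨ cong B (translation t (v ⊕ a)) ⟨
      B (act H (idMat , t) (v ⊕ a)) ≡⟨ fixed (v ⊕ a) ⟩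
      B (v ⊕ a)                     ∎
    ... | inj₂ moved = ⊥-elim (true≢false Ct (begin
      B (t ⊕ a)               ≡⟨ cong B (trans (comm t a) (sym (translation t a))) ⟩
      B (act H (idMat , t) a) ≡⟨ moved a Ba ⟩
      false                   ∎))

    fix-a : Mat p d → Mat p d × V
    fix-a A = A , a ⊖ A · a

    fix-a-fixes : ∀ A → act H (fix-a A) a ≡ a
    fix-a-fixes A = trans (sym (assoc (A · a) a (⊝ (A · a)))) (xyx⁻¹≈y (A · a) a)

    C-invariant : ∀ {A} → mem H A → ∀ w → C (A · w) ≡ C w
    C-invariant {A} A∈H w with isBlock (fix-a A) A∈H
    ... | inj₁ fixed = trans (cong B (sym fix-a[w+a]≡Aw+a)) (fixed (w ⊕ a))
      where
      fix-a[w+a]≡Aw+a : act H (fix-a A) (w ⊕ a) ≡ (A · w) ⊕ a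
      fix-a[w+a]≡Aw+a = begin
        (A · (w ⊕ a)) ⊕ (a ⊖ A · a)       ≡⟨ cong (_⊕ (a ⊖ A · a)) (·-distrib-⊕ A w a) ⟩
        ((A · w) ⊕ (A · a)) ⊕ (a ⊖ A · a) ≡⟨ assoc (A · w) (A · a) (a ⊖ A · a) ⟩
        (A · w) ⊕ ((A · a) ⊕ (a ⊖ A · a)) ≡⟨ cong ((A · w) ⊕_) (fix-a-fixes A) ⟩
        (A · w) ⊕ a                       ∎
    ... | inj₂ moved = ⊥-elim (true≢false Ba (trans (cong B (sym (fix-a-fixes A))) (moved a Ba)))

  record OrbitRepresentatives (u₁ u₂ u₃ : V) : Set where
    field
      u₁≢0  : u₁ ≢ zeroV
      u₂≢0  : u₂ ≢ zeroV
      u₃≢0  : u₃ ≢ zeroV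
      u₁≁u₂ : ¬ SameHOrbit H u₁ u₂
      u₁≁u₃ : ¬ SameHOrbit H u₁ u₃
      u₂≁u₃ : ¬ SameHOrbit H u₂ u₃
      cover : ∀ w → w ≢ zeroV → SameHOrbit H u₁ w ⊎ SameHOrbit H u₂ w ⊎ SameHOrbit H u₃ w

  swap₁₂ : ∀ {u₁ u₂ u₃} → OrbitRepresentatives u₁ u₂ u₃ → OrbitRepresentatives u₂ u₁ u₃
  swap₁₂ R = record
    { u₁≢0 = u₂≢0 ; u₂≢0 = u₁≢0 ; u₃≢0 = u₃≢0
    ; u₁≁u₂ = u₁≁u₂ ∘ same-sym ; u₁≁u₃ = u₂≁u₃ ; u₂≁u₃ = u₁≁u₃
    ; cover = λ w w≢0 → [ inj₂ ∘ inj₁ , [ inj₁ , inj₂ ∘ inj₂ ]′ ]′ (cover w w≢0)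
    }
    where open OrbitRepresentatives R

  swap₂₃ : ∀ {u₁ u₂ u₃} → OrbitRepresentatives u₁ u₂ u₃ → OrbitRepresentatives u₁ u₃ u₂
  swap₂₃ R = record
    { u₁≢0 = u₁≢0 ; u₂≢0 = u₃≢0 ; u₃≢0 = u₂≢0
    ; u₁≁u₂ = u₁≁u₃ ; u₁≁u₃ = u₁≁u₂ ; u₂≁u₃ = u₂≁u₃ ∘ same-sym
    ; cover = λ w w≢0 → [ inj₁ , [ inj₂ ∘ inj₂ , inj₂ ∘ inj₁ ]′ ]′ (cover w w≢0)
    }
    where open OrbitRepresentatives R

  module InvariantSubgroup
    (equal-sizes : ∀ x y → x ≢ zeroV → y ≢ zeroV → orbitSize x ≡ orbitSize y)
    (large-orbits : ∀ u → u ≢ zeroV → 2 ≤ orbitSize u)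
    (C : V → Bool) (C-zero : C zeroV ≡ true)
    (translate-by-member : ∀ {t} → C t ≡ true → ∀ v → C (t ⊕ v) ≡ C v)
    (C-invariant : ∀ {A} → mem H A → ∀ w → C (A · w) ≡ C w) where

    open Subgroup C translate-by-member

    C-orbit : ∀ {u w} → Orbit u w → C w ≡ C u
    C-orbit u↦w with orbit⇒same u↦w
    ... | A , A∈H , refl = C-invariant A∈H _

    orbit-nonzero : ∀ {u w} → u ≢ zeroV → Orbit u w → w ≢ zeroV
    orbit-nonzero u≢0 u↦w refl = u≢0 (same-zero (orbit⇒same u↦w))

    orbits-disjoint : ∀ {u u′ w} → ¬ SameHOrbit H u u′ → Orbit u w → Orbit u′ w → ⊥
    orbits-disjoint u≁u′ u↦w u′↦w = u≁u′ (same-trans (orbit⇒same u↦w) (same-sym (orbit⇒same u′↦w)))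

    module _ {ua ub uc} (R : OrbitRepresentatives ua ub uc) where

      open OrbitRepresentatives R

      s : ℕ
      s = orbitSize ua

      #orbit-ub : # (orbit? ub) ≡ s
      #orbit-ub = equal-sizes ub ua u₂≢0 u₁≢0

      #orbit-uc : # (orbit? uc) ≡ s
      #orbit-uc = equal-sizes uc ua u₃≢0 u₁≢0

      classify : ∀ w → w ≡ zeroV ⊎ Orbit ua w ⊎ Orbit ub w ⊎ Orbit uc w
      classify w with w ≟V zeroV
      ... | yes w≡0 = inj₁ w≡0
      ... | no  w≢0 = inj₂ (Sum.map same⇒orbit (Sum.map same⇒orbit same⇒orbit) (cover w w≢0))

      zero-or-ua? : Decidable (λ w → w ≡ zeroV ⊎ Orbit ua w)
      zero-or-ua? w = (w ≟V zeroV) ⊎-dec orbit? ua w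

      #zero-or-ua : suc s ≤ # zero-or-ua?
      #zero-or-ua = subst (_≤ # zero-or-ua?) (cong (_+ s) (count-singleton zeroV))
        (count-disjoint (_≟V zeroV) (orbit? ua) zero-or-ua?
          (λ { refl ua↦0 → orbit-nonzero u₁≢0 ua↦0 refl }) inj₁ inj₂)

      zero-or-ua⊆C : C ua ≡ true → ∀ {w} → w ≡ zeroV ⊎ Orbit ua w → C w ≡ true
      zero-or-ua⊆C Ca (inj₁ refl)  = C-zero
      zero-or-ua⊆C Ca (inj₂ ua↦w) = trans (C-orbit ua↦w) Ca

      module _ (Ca : C ua ≡ true) (Cb : C ub ≡ false) (Cc : C uc ≡ false) where

        C⊆zero-or-ua : ∀ {w} → C w ≡ true → w ≡ zeroV ⊎ Orbit ua w
        C⊆zero-or-ua {w} Cw with classify w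
        ... | inj₁ w≡0                = inj₁ w≡0
        ... | inj₂ (inj₁ ua↦w)        = inj₂ ua↦w
        ... | inj₂ (inj₂ (inj₁ ub↦w)) = ⊥-elim (true≢false Cw (trans (C-orbit ub↦w) Cb))
        ... | inj₂ (inj₂ (inj₂ uc↦w)) = ⊥-elim (true≢false Cw (trans (C-orbit uc↦w) Cc))

        N⊆ub∪uc : ∀ {w} → C w ≡ false → Orbit ub w ⊎ Orbit uc w
        N⊆ub∪uc {w} Cw with classify w
        ... | inj₁ refl           = ⊥-elim (true≢false C-zero Cw)
        ... | inj₂ (inj₁ ua↦w)    = ⊥-elim (true≢false (trans (C-orbit ua↦w) Ca) Cw)
        ... | inj₂ (inj₂ ub∪uc↦w) = ub∪uc↦w

        #C≤ : # member? ≤ suc s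
        #C≤ = subst (# member? ≤_) (cong (_+ s) (count-singleton zeroV))
                (count-union (_≟V zeroV) (orbit? ua) member? C⊆zero-or-ua)

        #C≥ : suc s ≤ # member?
        #C≥ = ℕ.≤-trans #zero-or-ua (count-mono zero-or-ua? member? (zero-or-ua⊆C Ca))

        #N≤ : # nonmember? ≤ s + s
        #N≤ = subst (# nonmember? ≤_) (cong₂ _+_ #orbit-ub #orbit-uc)
                (count-union (orbit? ub) (orbit? uc) nonmember? N⊆ub∪uc)

        #N≥ : s + s ≤ # nonmember?
        #N≥ = subst (_≤ # nonmember?) (cong₂ _+_ #orbit-ub #orbit-uc)
                (count-disjoint (orbit? ub) (orbit? uc) nonmember? (orbits-disjoint u₂≁u₃)
                  (λ ub↦w → trans (C-orbit ub↦w) Cb) (λ uc↦w → trans (C-orbit uc↦w) Cc))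

        -- C ∪ N = V with ∣C∣ = 1 + s and ∣N∣ = 2s, while ∣N∣ is either ∣C∣ or at least 2∣C∣.
        only-ua-in-C-impossible : ⊥
        only-ua-in-C-impossible with complement-size Cb
        ... | inj₁ #N≡#C = contradiction (ℕ.≤-trans (large-orbits ua u₁≢0) s≤1) λ { (s≤s ()) }
          where
          s≤1 : s ≤ 1
          s≤1 = ℕ.+-cancelʳ-≤ s s 1 (ℕ.≤-trans #N≥ (ℕ.≤-trans (ℕ.≤-reflexive #N≡#C) #C≤))
        ... | inj₂ #C+#C≤#N = ℕ.<⇒≱ (ℕ.+-mono-< (ℕ.n<1+n s) (ℕ.n<1+n s))
                                (ℕ.≤-trans (ℕ.+-mono-≤ #C≥ #C≥) (ℕ.≤-trans #C+#C≤#N #N≤))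

      only-ua,ub-in-C-impossible : C ua ≡ true → C ub ≡ true → C uc ≡ false → ⊥
      only-ua,ub-in-C-impossible Ca Cb Cc =
        ℕ.<⇒≱ (s≤s (ℕ.m≤m+n s s)) (ℕ.≤-trans #C≥1+2s (ℕ.≤-trans (#member≤#nonmember Cc) #N≤s))
        where
        #C≥1+2s : suc (s + s) ≤ # member?
        #C≥1+2s = ℕ.≤-trans (ℕ.+-mono-≤ #zero-or-ua (ℕ.≤-reflexive (sym #orbit-ub)))
          (count-disjoint zero-or-ua? (orbit? ub) member?
            (λ { (inj₁ refl) ub↦0 → orbit-nonzero u₂≢0 ub↦0 refl
               ; (inj₂ ua↦w) ub↦w → orbits-disjoint u₁≁u₂ ua↦w ub↦w })
            (zero-or-ua⊆C Ca) (λ ub↦w → trans (C-orbit ub↦w) Cb))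
        N⊆uc : ∀ {w} → C w ≡ false → Orbit uc w
        N⊆uc {w} Cw with classify w
        ... | inj₁ refl               = ⊥-elim (true≢false C-zero Cw)
        ... | inj₂ (inj₁ ua↦w)        = ⊥-elim (true≢false (trans (C-orbit ua↦w) Ca) Cw)
        ... | inj₂ (inj₂ (inj₁ ub↦w)) = ⊥-elim (true≢false (trans (C-orbit ub↦w) Cb) Cw)
        ... | inj₂ (inj₂ (inj₂ uc↦w)) = uc↦w
        #N≤s : # nonmember? ≤ s
        #N≤s = ℕ.≤-trans (count-mono nonmember? (orbit? uc) N⊆uc) (ℕ.≤-reflexive #orbit-uc)

    third-orbit-in-C : ∀ {ua ub uc} → OrbitRepresentatives ua ub uc → C ua ≡ true → C ub ≡ true → C uc ≡ true
    third-orbit-in-C {uc = uc} R Ca Cb with C uc in Cc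
    ... | true  = refl
    ... | false = ⊥-elim (only-ua,ub-in-C-impossible R Ca Cb Cc)

    second-orbit-in-C : ∀ {ua ub uc} → OrbitRepresentatives ua ub uc → C ua ≡ true → C ub ≡ true
    second-orbit-in-C {ub = ub} {uc} R Ca with C ub in Cb | C uc in Cc
    ... | true  | _     = refl
    ... | false | true  = ⊥-elim (true≢false (third-orbit-in-C (swap₂₃ R) Ca Cc) Cb)
    ... | false | false = ⊥-elim (only-ua-in-C-impossible R Ca Cb Cc)

    first-orbit-in-C⇒everything : ∀ {ua ub uc} → OrbitRepresentatives ua ub uc → C ua ≡ true → ∀ w → C w ≡ true
    first-orbit-in-C⇒everything R Ca w with classify R w
    ... | inj₁ refl               = C-zero
    ... | inj₂ (inj₁ ua↦w)        = trans (C-orbit ua↦w) Ca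
    ... | inj₂ (inj₂ (inj₁ ub↦w)) = trans (C-orbit ub↦w) (second-orbit-in-C R Ca)
    ... | inj₂ (inj₂ (inj₂ uc↦w)) = trans (C-orbit uc↦w) (second-orbit-in-C (swap₂₃ R) Ca)

    nonzero-member⇒everything : ∀ {u₁ u₂ u₃} → OrbitRepresentatives u₁ u₂ u₃ →
                                ∀ {t} → t ≢ zeroV → C t ≡ true → ∀ w → C w ≡ true
    nonzero-member⇒everything R {t} t≢0 Ct =
      [ first-orbit-in-C⇒everything R ∘ in-C
      , [ first-orbit-in-C⇒everything (swap₁₂ R) ∘ in-C
        , first-orbit-in-C⇒everything (swap₁₂ (swap₂₃ R)) ∘ in-C ]′ ]′
      (OrbitRepresentatives.cover R t t≢0)
      where
      in-C : ∀ {u} → SameHOrbit H u t → C u ≡ true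
      in-C u∼t = trans (sym (C-orbit (same⇒orbit u∼t))) Ct

  blocks-trivial : (∀ x y → x ≢ zeroV → y ≢ zeroV → orbitSize x ≡ orbitSize y) →
                   (∀ u → u ≢ zeroV → 2 ≤ orbitSize u) →
                   ∀ {u₁ u₂ u₃} → OrbitRepresentatives u₁ u₂ u₃ →
                   ∀ B → IsBlock H B → TrivialBlock H B
  blocks-trivial equal-sizes large-orbits R B isBlock with atMostOne⊎twoDistinct (λ x → B x Bool.≟ true)
  ... | inj₁ atMostOne = inj₁ atMostOne
  ... | inj₂ (a , b , Ba , Bb , a≢b) = inj₂ λ c → begin
    B c       ≡⟨ cong B (//-rightDividesˡ a c) ⟨
    C (c ⊖ a) ≡⟨ nonzero-member⇒everything R b-a≢0 Cb-a (c ⊖ a) ⟩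
    true      ∎
    where
    open Block B isBlock Ba
    open InvariantSubgroup equal-sizes large-orbits C C-zero translate-by-member C-invariant
    b-a≢0 : b ⊖ a ≢ zeroV
    b-a≢0 b-a≡0 = a≢b (sym (x∙y⁻¹≈ε⇒x≈y b a b-a≡0))
    Cb-a : C (b ⊖ a) ≡ true
    Cb-a = trans (cong B (//-rightDividesˡ a b)) Bb

lemma2p8 : (p : ℕ) .{{_ : NonZero p}} → Prime p → (d : ℕ) → (H : MatGroup p d) →
           NontrivialH H → ThreeHalvesTransitive H → ExactlyThreeOrbits H → Primitive H
lemma2p8 p _ d H _ (transitive , nonregular , equal-sizes)
         (u₁ , u₂ , u₃ , u₁≢0 , u₂≢0 , u₃≢0 , u₁≁u₂ , u₁≁u₃ , u₂≁u₃ , cover) =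
  transitive , blocks-trivial equal-sizes₀ large-orbits representatives
  where
  open AffineGroup H
  equal-sizes₀ : ∀ x y → x ≢ zeroV → y ≢ zeroV → orbitSize x ≡ orbitSize y
  equal-sizes₀ = equal-sizes zeroV
  large-orbits : ∀ u → u ≢ zeroV → 2 ≤ orbitSize u
  large-orbits = nonregular⇒large-orbits transitive nonregular equal-sizes₀
  representatives : OrbitRepresentatives u₁ u₂ u₃
  representatives = record
    { u₁≢0 = u₁≢0 ; u₂≢0 = u₂≢0 ; u₃≢0 = u₃≢0
    ; u₁≁u₂ = u₁≁u₂ ; u₁≁u₃ = u₁≁u₃ ; u₂≁u₃ = u₂≁u₃
    ; cover = cover
    }
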